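{- Let $G$ be a graph with independence number $\alpha(G)=2$. For every coloring of the edges of $G$ with $2$ colors, there exist at most two monochromatic connected subgraphs of $G$, each of diameter at most $6$, whose vertex sets together cover $V(G)$.
   Context: A subgraph is monochromatic if all of its edges have the same color; the subgraphs in the cover may have different colors. The diameter of a connected graph is the maximum over pairs of vertices of the distance between them. $\alpha(G)$ denotes the maximum size of an independent set of vertices in $G$. -}

module Defs where

open import Data.Nat using (ℕ; zero; suc; _≤_)
open import Data.Bool using (Bool; true; false)
open import Data.Fin using (Fin)
open import Data.Fin.Subset using (Subset; _∈_; ∣_∣)
open import Data.Product using (Σ; ∃; _×_; _,_)
open import Relation.Binary.PropositionalEquality using (_≡_; _≢_)

record Graph (n : ℕ) : Set where
  field
    adj    : Fin n → Fin n → Bool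
    sym    : ∀ u v → adj u v ≡ adj v u
    irrefl : ∀ v → adj v v ≡ false
open Graph public

-- A 2-colouring of the edges of G: a symmetric colour assignment on pairs;
-- only its values on edges of G matter.
record EdgeColouring {n : ℕ} (G : Graph n) : Set where
  field
    colour    : Fin n → Fin n → Fin 2
    colourSym : ∀ u v → colour u v ≡ colour v u
open EdgeColouring public

IndependentSet : ∀ {n} → Graph n → Subset n → Set
IndependentSet G S = ∀ u v → u ∈ S → v ∈ S → u ≢ v → adj G u v ≡ false

IndependenceNumber : ∀ {n} → Graph n → ℕ → Set
IndependenceNumber {n} G k =
  (Σ (Subset n) λ S → IndependentSet G S × ∣ S ∣ ≡ k) ×
  (∀ (S : Subset n) → IndependentSet G S → ∣ S ∣ ≤ k)

record Subgraph {n : ℕ} (G : Graph n) : Set where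
  field
    verts     : Subset n
    edge      : Fin n → Fin n → Bool
    edgeSym   : ∀ u v → edge u v ≡ edge v u
    edgeInG   : ∀ u v → edge u v ≡ true → adj G u v ≡ true
    edgeVerts : ∀ u v → edge u v ≡ true → u ∈ verts × v ∈ verts
open Subgraph public

Monochromatic : ∀ {n} {G : Graph n} → EdgeColouring G → Subgraph G → Set
Monochromatic χ H = ∃ λ c → ∀ u v → edge H u v ≡ true → colour χ u v ≡ c

data WalkLE {n : ℕ} {G : Graph n} (H : Subgraph G) : ℕ → Fin n → Fin n → Set where
  here : ∀ {k v} → WalkLE H k v v
  step : ∀ {k u w v} → edge H u w ≡ true → WalkLE H k w v → WalkLE H (suc k) u v

ConnectedDiamLE : ∀ {n} {G : Graph n} → Subgraph G → ℕ → Set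
ConnectedDiamLE {n} H d =
  (∃ λ (v : Fin n) → v ∈ verts H) ×
  (∀ u v → u ∈ verts H → v ∈ verts H → WalkLE H d u v)

-- Since α(G) = 2, the non-neighbours of any vertex form a clique, and in a 2-coloured
-- clique each vertex reaches all the others by walks of length at most 2 in one colour.
-- For non-adjacent x and y this puts the non-neighbours of y in a colour-α ball of
-- radius 2 around x and the non-neighbours of x in a colour-β ball around y; everything
-- else is a common neighbour of x and y.  Monochromatic balls of radius 3 have diameter
-- at most 6, and a pair of them always covers G: if α = β and the two α-balls around x
-- and y miss a vertex v, then v reaches all its neighbours within distance 2 in the
-- other colour, so balls around v and around a non-neighbour of v suffice; if α ≠ β and
-- the pairs of balls of colours (α, β), (α, α), (β, β) around (x, y) each miss a vertex,
-- those three vertices are pairwise non-adjacent.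

module Submission where

open import Defs hiding (sym)
open import Data.Nat using (ℕ)
open import Data.Fin using (Fin)
open import Data.Fin.Subset using (_∈_)
open import Data.Product using (Σ; _×_)
open import Data.Sum using (_⊎_)

open import Data.Nat using (zero; suc; _+_; _≤_; _<_; s≤s)
open import Data.Nat.Properties
  using (≤-refl; <⇒≤; <⇒≱; n≤1+n; m≤n+m; suc-injective; module ≤-Reasoning)
open import Data.Bool using (Bool; true; false; _∧_)
open import Data.Bool.Properties using (∧-comm) renaming (_≟_ to _≟ᵇ_)
open import Data.Fin using (zero; suc)
open import Data.Fin.Properties using (_≟_; any?)
import Data.Fin.Properties as Fin
open import Data.Fin.Subset using (Subset; ⊤; ⁅_⁆; _∪_; _∉_; ∣_∣; Nonempty)
open import Data.Fin.Subset.Properties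
  using (∈⊤; x∈⁅x⁆; x∈⁅y⁆⇒x≡y; x≢y⇒x∉⁅y⁆; q⊆p∪q; x∈p∪q⁺; x∈p∪q⁻; ∣⁅x⁆∣≡1; p⊂q⇒∣p∣<∣q∣)
open import Data.Vec using (_∷_; tabulate; here; there)
open import Data.Vec.Properties using (lookup∘tabulate; []=⇒lookup; lookup⇒[]=)
open import Data.Product using (∃; ∃₂; _,_; proj₁; proj₂)
open import Data.Sum using (inj₁; inj₂; [_,_]) renaming (map to ⊎-map; map₂ to ⊎-map₂)
open import Data.Empty using (⊥; ⊥-elim)
open import Function using (_∘_)
open import Relation.Nullary using (¬_; Dec; yes; no; does)
open import Relation.Nullary.Decidable using (¬?; _×-dec_; _⊎-dec_; dec-true; decidable-stable)
open import Relation.Unary using (Pred; Decidable)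
open import Relation.Binary.PropositionalEquality using (_≡_; _≢_; refl; sym; trans; cong; cong₂)

∧-true⁺ : ∀ {a b} → a ≡ true → b ≡ true → a ∧ b ≡ true
∧-true⁺ refl refl = refl

∧-true⁻ : ∀ a {b} → a ∧ b ≡ true → a ≡ true × b ≡ true
∧-true⁻ true {true} _ = refl , refl

∈-tabulate⁺ : ∀ {m} {f : Fin m → Bool} {u} → f u ≡ true → u ∈ tabulate f
∈-tabulate⁺ {f = f} {u} fu = lookup⇒[]= u _ (trans (lookup∘tabulate f u) fu)

∈-tabulate⁻ : ∀ {m} {f : Fin m → Bool} {u} → u ∈ tabulate f → f u ≡ true
∈-tabulate⁻ {f = f} {u} u∈ = trans (sym (lookup∘tabulate f u)) ([]=⇒lookup u∈)

member-of-size : ∀ {m} (p : Subset m) {k} → ∣ p ∣ ≡ suc k → Nonempty p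
member-of-size (true  ∷ p) _ = zero , here
member-of-size (false ∷ p) e = let a , a∈p = member-of-size p e in suc a , there a∈p

two-members-of-size : ∀ {m} (p : Subset m) {k} → ∣ p ∣ ≡ suc (suc k) →
  ∃₂ λ a b → a ∈ p × b ∈ p × a ≢ b
two-members-of-size (true ∷ p) e =
  let b , b∈p = member-of-size p (suc-injective e) in zero , suc b , here , there b∈p , λ ()
two-members-of-size (false ∷ p) e =
  let a , b , a∈p , b∈p , a≢b = two-members-of-size p e in
  suc a , suc b , there a∈p , there b∈p , a≢b ∘ Fin.suc-injective

∣p∣<∣⁅x⁆∪p∣ : ∀ {m} {x : Fin m} {p} → x ∉ p → ∣ p ∣ < ∣ ⁅ x ⁆ ∪ p ∣
∣p∣<∣⁅x⁆∪p∣ {x = x} {p} x∉p = p⊂q⇒∣p∣<∣q∣ (q⊆p∪q ⁅ x ⁆ p , x , x∈p∪q⁺ (inj₁ (x∈⁅x⁆ x)) , x∉p)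

module _ {m} {a b c : Fin m} where

  ∈⁅a,b,c⁆⁻ : ∀ {z} → z ∈ ⁅ a ⁆ ∪ ⁅ b ⁆ ∪ ⁅ c ⁆ → z ≡ a ⊎ z ≡ b ⊎ z ≡ c
  ∈⁅a,b,c⁆⁻ = ⊎-map (x∈⁅y⁆⇒x≡y a) (⊎-map (x∈⁅y⁆⇒x≡y b) (x∈⁅y⁆⇒x≡y c) ∘ x∈p∪q⁻ ⁅ b ⁆ ⁅ c ⁆)
            ∘ x∈p∪q⁻ ⁅ a ⁆ _

  2<∣⁅a,b,c⁆∣ : a ≢ b → a ≢ c → b ≢ c → 2 < ∣ ⁅ a ⁆ ∪ ⁅ b ⁆ ∪ ⁅ c ⁆ ∣
  2<∣⁅a,b,c⁆∣ a≢b a≢c b≢c = begin-strict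
    2                     ≡⟨ cong suc (sym (∣⁅x⁆∣≡1 c)) ⟩
    suc ∣ ⁅ c ⁆ ∣           ≤⟨ ∣p∣<∣⁅x⁆∪p∣ (x≢y⇒x∉⁅y⁆ b≢c) ⟩
    ∣ ⁅ b ⁆ ∪ ⁅ c ⁆ ∣       <⟨ ∣p∣<∣⁅x⁆∪p∣ a∉⁅b,c⁆ ⟩
    ∣ ⁅ a ⁆ ∪ ⁅ b ⁆ ∪ ⁅ c ⁆ ∣ ∎
    where
    open ≤-Reasoning
    a∉⁅b,c⁆ : a ∉ ⁅ b ⁆ ∪ ⁅ c ⁆
    a∉⁅b,c⁆ = [ a≢b ∘ x∈⁅y⁆⇒x≡y b , a≢c ∘ x∈⁅y⁆⇒x≡y c ] ∘ x∈p∪q⁻ ⁅ b ⁆ ⁅ c ⁆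

other : Fin 2 → Fin 2
other zero       = suc zero
other (suc zero) = zero

other-involutive : ∀ c → other (other c) ≡ c
other-involutive zero       = refl
other-involutive (suc zero) = refl

colour-cases : ∀ c d → d ≡ c ⊎ d ≡ other c
colour-cases zero       zero       = inj₁ refl
colour-cases zero       (suc zero) = inj₂ refl
colour-cases (suc zero) zero       = inj₂ refl
colour-cases (suc zero) (suc zero) = inj₁ refl

≢⇒other : ∀ {c c'} → c ≢ c' → c' ≡ other c
≢⇒other {c} {c'} c≢c' with colour-cases c c'
... | inj₁ c'≡c = ⊥-elim (c≢c' (sym c'≡c))
... | inj₂ c'≡c̄ = c'≡c̄

module _ {n} {G : Graph n} {H : Subgraph G} where

  edge-sym : ∀ {u w} → edge H u w ≡ true → edge H w u ≡ true
  edge-sym {u} {w} e = trans (edgeSym H w u) e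

  weaken : ∀ {j k u v} → j ≤ k → WalkLE H j u v → WalkLE H k u v
  weaken _         here       = here
  weaken (s≤s j≤k) (step e p) = step e (weaken j≤k p)

  ¬walk⇒≢ : ∀ {k u v} → ¬ WalkLE H k u v → u ≢ v
  ¬walk⇒≢ ¬p refl = ¬p here

  ¬weaken : ∀ {j k u v} → j ≤ k → ¬ WalkLE H k u v → ¬ WalkLE H j u v
  ¬weaken j≤k ¬p = ¬p ∘ weaken j≤k

  _++_ : ∀ {j k u v w} → WalkLE H j u v → WalkLE H k v w → WalkLE H (j + k) u w
  _++_ {j} {k} here q = weaken (m≤n+m k j) q
  step e p ++ q       = step e (p ++ q)

  snoc : ∀ {k u v w} → WalkLE H k u v → edge H v w ≡ true → WalkLE H (suc k) u w
  snoc here       e = step e here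
  snoc (step e p) f = step e (snoc p f)

  reverse : ∀ {k u v} → WalkLE H k u v → WalkLE H k v u
  reverse here       = here
  reverse (step e p) = snoc (reverse p) (edge-sym e)

module _ {n} {G : Graph n} (H : Subgraph G) where

  walkLE? : ∀ k u v → Dec (WalkLE H k u v)
  walkLE? zero u v with u ≟ v
  ... | yes refl = yes here
  ... | no u≢v   = no λ { here → u≢v refl }
  walkLE? (suc k) u v with u ≟ v | any? (λ w → (edge H u w ≟ᵇ true) ×-dec walkLE? k w v)
  ... | yes refl | _                = yes here
  ... | no _     | yes (w , e , p)  = yes (step e p)
  ... | no u≢v   | no ¬step         = no λ { here → u≢v refl ; (step e p) → ¬step (_ , e , p) }

  module _ (r : ℕ) (v : Fin n) where

    -- Walks run towards the centre v, so prefixing an edge with step moves away from v.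
    near : Fin n → Bool
    near u = does (walkLE? r u v)

    ball : Subgraph G
    ball = record
      { verts     = tabulate near
      ; edge      = λ u w → edge H u w ∧ (near u ∧ near w)
      ; edgeSym   = λ u w → cong₂ _∧_ (edgeSym H u w) (∧-comm (near u) (near w))
      ; edgeInG   = λ u w e → edgeInG H u w (proj₁ (∧-true⁻ (edge H u w) e))
      ; edgeVerts = λ u w e → let nu , nw = ∧-true⁻ (near u) (proj₂ (∧-true⁻ (edge H u w) e))
                              in ∈-tabulate⁺ nu , ∈-tabulate⁺ nw
      }

    near⁺ : ∀ {k u} → k ≤ r → WalkLE H k u v → near u ≡ true
    near⁺ {u = u} k≤r p = dec-true (walkLE? r u v) (weaken k≤r p)

    near⁻ : ∀ {u} → near u ≡ true → WalkLE H r u v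
    near⁻ {u} with walkLE? r u v
    ... | yes p = λ _ → p

    ∈-ball⁺ : ∀ {u} → WalkLE H r u v → u ∈ verts ball
    ∈-ball⁺ = ∈-tabulate⁺ ∘ near⁺ ≤-refl

    ∈-ball⁻ : ∀ {u} → u ∈ verts ball → WalkLE H r u v
    ∈-ball⁻ = near⁻ ∘ ∈-tabulate⁻

    -- Every suffix of a walk to v is again a walk to v, so all its vertices lie in the ball.
    lift-to-ball : ∀ {k u} → k ≤ r → WalkLE H k u v → WalkLE ball k u v
    lift-to-ball k≤r here = here
    lift-to-ball k<r (step e p) =
      step (∧-true⁺ e (∧-true⁺ (near⁺ k<r (step e p)) (near⁺ (<⇒≤ k<r) p))) (lift-to-ball (<⇒≤ k<r) p)

    ball-connectedDiam : ConnectedDiamLE ball (r + r)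
    ball-connectedDiam = (v , ∈-ball⁺ here) , λ u w u∈ w∈ → to-centre u∈ ++ reverse (to-centre w∈)
      where
      to-centre : ∀ {u} → u ∈ verts ball → WalkLE ball r u v
      to-centre = lift-to-ball ≤-refl ∘ ∈-ball⁻

    ball-monochromatic : (χ : EdgeColouring G) → Monochromatic χ H → Monochromatic χ ball
    ball-monochromatic χ (c , mono) = c , λ u w e → mono u w (proj₁ (∧-true⁻ (edge H u w) e))

NonNeighbour : ∀ {n} → Graph n → Fin n → Fin n → Set
NonNeighbour G p z = z ≢ p × adj G z p ≡ false

nonNeighbour? : ∀ {n} (G : Graph n) p → Decidable (NonNeighbour G p)
nonNeighbour? G p z = ¬? (z ≟ p) ×-dec (adj G z p ≟ᵇ false)

Clique : ∀ {n ℓ} → Graph n → Pred (Fin n) ℓ → Set ℓ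
Clique G K = ∀ {u w} → K u → K w → u ≢ w → adj G u w ≡ true

NoIndependentTriple : ∀ {n} → Graph n → Set
NoIndependentTriple {n} G = ∀ {a b c : Fin n} → a ≢ b → a ≢ c → b ≢ c →
  adj G a b ≡ false → adj G a c ≡ false → adj G b c ≡ false → ⊥

module _ {n} (G : Graph n) where

  independentPair : IndependenceNumber G 2 → ∃₂ λ x y → x ≢ y × adj G x y ≡ false
  independentPair ((S , S-independent , ∣S∣≡2) , _) =
    let x , y , x∈S , y∈S , x≢y = two-members-of-size S ∣S∣≡2 in
    x , y , x≢y , S-independent x y x∈S y∈S x≢y

  noIndependentTriple : IndependenceNumber G 2 → NoIndependentTriple G
  noIndependentTriple (_ , maximal) {a} {b} {c} a≢b a≢c b≢c ab ac bc =
    <⇒≱ (2<∣⁅a,b,c⁆∣ a≢b a≢c b≢c) (maximal T T-independent)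
    where
    T = ⁅ a ⁆ ∪ ⁅ b ⁆ ∪ ⁅ c ⁆
    flip-adj : ∀ {u v} → adj G u v ≡ false → adj G v u ≡ false
    flip-adj {u} {v} = trans (Graph.sym G v u)
    nonadjacent : ∀ {u v} → u ≡ a ⊎ u ≡ b ⊎ u ≡ c → v ≡ a ⊎ v ≡ b ⊎ v ≡ c → u ≢ v → adj G u v ≡ false
    nonadjacent (inj₁ refl)        (inj₂ (inj₁ refl)) _ = ab
    nonadjacent (inj₁ refl)        (inj₂ (inj₂ refl)) _ = ac
    nonadjacent (inj₂ (inj₁ refl)) (inj₂ (inj₂ refl)) _ = bc
    nonadjacent (inj₂ (inj₁ refl)) (inj₁ refl)        _ = flip-adj ab
    nonadjacent (inj₂ (inj₂ refl)) (inj₁ refl)        _ = flip-adj ac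
    nonadjacent (inj₂ (inj₂ refl)) (inj₂ (inj₁ refl)) _ = flip-adj bc
    nonadjacent (inj₁ refl)        (inj₁ refl)        u≢v = ⊥-elim (u≢v refl)
    nonadjacent (inj₂ (inj₁ refl)) (inj₂ (inj₁ refl)) u≢v = ⊥-elim (u≢v refl)
    nonadjacent (inj₂ (inj₂ refl)) (inj₂ (inj₂ refl)) u≢v = ⊥-elim (u≢v refl)
    T-independent : IndependentSet G T
    T-independent u v u∈T v∈T = nonadjacent (∈⁅a,b,c⁆⁻ u∈T) (∈⁅a,b,c⁆⁻ v∈T)

module Colouring {n} {G : Graph n} (χ : EdgeColouring G) where

  colourClass : Fin 2 → Subgraph G
  colourClass c = record
    { verts     = ⊤
    ; edge      = λ u w → adj G u w ∧ does (colour χ u w ≟ c)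
    ; edgeSym   = λ u w → cong₂ _∧_ (Graph.sym G u w) (cong (λ d → does (d ≟ c)) (colourSym χ u w))
    ; edgeInG   = λ u w e → proj₁ (∧-true⁻ (adj G u w) e)
    ; edgeVerts = λ _ _ _ → ∈⊤ , ∈⊤
    }

  colourClass-monochromatic : ∀ c → Monochromatic χ (colourClass c)
  colourClass-monochromatic c = c , λ u w e → ≟-sound (proj₂ (∧-true⁻ (adj G u w) e))
    where
    ≟-sound : ∀ {d} → does (d ≟ c) ≡ true → d ≡ c
    ≟-sound {d} t with d ≟ c
    ... | yes d≡c = d≡c

  colour-edge : ∀ {c u w} → adj G u w ≡ true → colour χ u w ≡ c → edge (colourClass c) u w ≡ true
  colour-edge {c} {u} {w} a refl = ∧-true⁺ a (dec-true (colour χ u w ≟ c) refl)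

  Reach : Fin 2 → ℕ → Fin n → Fin n → Set
  Reach c = WalkLE (colourClass c)

  reach? : ∀ c k u v → Dec (Reach c k u v)
  reach? c = walkLE? (colourClass c)

  colour-leaving : ∀ {c k z x} → ¬ Reach c (suc k) z x → adj G z x ≡ true → colour χ z x ≡ other c
  colour-leaving {c} {z = z} {x} ¬r a with colour-cases c (colour χ z x)
  ... | inj₁ q = ⊥-elim (¬r (step (colour-edge a q) here))
  ... | inj₂ q = q

  -- z reaches k directly in colour other c, or else through s.
  clique⊆otherBall₂ : ∀ {ℓ} {K : Pred (Fin n) ℓ} → Clique G K →
    ∀ {c k s} → K k → K s → ¬ Reach c 2 s k → ∀ {z} → K z → Reach (other c) 2 z k
  clique⊆otherBall₂ clique {c} {k} {s} Kk Ks ¬rs {z} Kz with z ≟ k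
  ... | yes refl = here
  ... | no z≢k with colour-cases c (colour χ z k)
  ...   | inj₂ czk = step (colour-edge (clique Kz Kk z≢k) czk) here
  ...   | inj₁ czk = step (colour-edge azs czs) (step (colour-edge ask (colour-leaving ¬rs ask)) here)
    where
    azk = clique Kz Kk z≢k
    s≢k : s ≢ k
    s≢k refl = ¬rs here
    ask = clique Ks Kk s≢k
    z≢s : z ≢ s
    z≢s refl = ¬rs (step (colour-edge azk czk) here)
    azs = clique Kz Ks z≢s
    czs : colour χ z s ≡ other c
    czs with colour-cases c (colour χ z s)
    ... | inj₁ q = ⊥-elim (¬rs (step (edge-sym {H = colourClass c} (colour-edge azs q))
                                      (step (colour-edge azk czk) here)))
    ... | inj₂ q = q

  clique⊆monoBall₂ : ∀ {ℓ} {K : Pred (Fin n) ℓ} → Decidable K → Clique G K →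
    ∀ {k} → K k → ∃ λ c → ∀ {z} → K z → Reach c 2 z k
  clique⊆monoBall₂ K? clique {k} Kk with any? (λ s → K? s ×-dec ¬? (reach? zero 2 s k))
  ... | yes (s , Ks , ¬rs) = other zero , clique⊆otherBall₂ clique Kk Ks ¬rs
  ... | no none            =
    zero , λ {z} Kz → decidable-stable (reach? zero 2 z k) (λ ¬rz → none (z , Kz , ¬rz))

  outside⇒adjacent : ∀ {c k x y z} → (∀ {z} → NonNeighbour G y z → Reach c k z x) →
    ¬ Reach c k z x → z ≢ y → adj G z y ≡ true
  outside⇒adjacent {y = y} {z = z} near ¬r z≢y with adj G z y in azy
  ... | true  = refl
  ... | false = ⊥-elim (¬r (near (z≢y , azy)))

  separated : ∀ {c k u w x y} → adj G u x ≡ true → colour χ u x ≡ c →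
    adj G w y ≡ true → colour χ w y ≡ other c →
    ¬ Reach c (2 + k) w x → ¬ Reach (other c) (2 + k) u y → u ≢ w × adj G u w ≡ false
  separated {c} {u = u} {w} aux cux awy cwy ¬rwx ¬ruy = u≢w , nonadjacent
    where
    u≢w : u ≢ w
    u≢w refl = ¬rwx (step (colour-edge aux cux) here)
    nonadjacent : adj G u w ≡ false
    nonadjacent with adj G u w in auw
    ... | false = refl
    ... | true with colour-cases c (colour χ u w)
    ...   | inj₁ q = ⊥-elim (¬rwx (step (edge-sym {H = colourClass c} (colour-edge auw q))
                                           (step (colour-edge aux cux) here)))
    ...   | inj₂ q = ⊥-elim (¬ruy (step (colour-edge auw q) (step (colour-edge awy cwy) here)))

  record BallCover (r : ℕ) : Set where
    constructor ballCover
    field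
      c₁     : Fin 2
      x₁     : Fin n
      c₂     : Fin 2
      x₂     : Fin n
      covers : ∀ z → Reach c₁ r z x₁ ⊎ Reach c₂ r z x₂

  ballCover? : ∀ r c₁ x₁ c₂ x₂ → BallCover r ⊎ ∃ λ z → ¬ Reach c₁ r z x₁ × ¬ Reach c₂ r z x₂
  ballCover? r c₁ x₁ c₂ x₂ with any? (λ z → ¬? (reach? c₁ r z x₁ ⊎-dec reach? c₂ r z x₂))
  ... | yes (z , ¬cov) = inj₂ (z , ¬cov ∘ inj₁ , ¬cov ∘ inj₂)
  ... | no none        = inj₁ (ballCover c₁ x₁ c₂ x₂ λ z →
                           decidable-stable (reach? c₁ r z x₁ ⊎-dec reach? c₂ r z x₂) (none ∘ (z ,_)))

module CoveringByBalls {n} {G : Graph n} (χ : EdgeColouring G) (noTriple : NoIndependentTriple G) where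

  open Colouring χ

  nonNeighbours-adjacent : ∀ {p} → Clique G (NonNeighbour G p)
  nonNeighbours-adjacent {p} {u} {w} (u≢p , aup) (w≢p , awp) u≢w with adj G u w in auw
  ... | true  = refl
  ... | false = ⊥-elim (noTriple u≢w u≢p w≢p auw aup awp)

  nonNeighbours⊆monoBall₂ : ∀ {p k} → NonNeighbour G p k →
    ∃ λ c → ∀ {z} → NonNeighbour G p z → Reach c 2 z k
  nonNeighbours⊆monoBall₂ {p} = clique⊆monoBall₂ (nonNeighbour? G p) nonNeighbours-adjacent

  near-or-nonNeighbour : ∀ {c v} → (∀ {z} → adj G z v ≡ true → Reach c 2 z v) →
    ∀ z → Reach c 3 z v ⊎ NonNeighbour G v z
  near-or-nonNeighbour {v = v} nbhd z with z ≟ v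
  ... | yes refl = inj₁ here
  ... | no z≢v with adj G z v in azv
  ...   | true  = inj₁ (weaken (n≤1+n 2) (nbhd azv))
  ...   | false = inj₂ (z≢v , refl)

  cover-from-centre : ∀ {c v} → (∀ {z} → adj G z v ≡ true → Reach c 2 z v) → BallCover 3
  cover-from-centre {c} {v} nbhd with any? (nonNeighbour? G v)
  ... | yes (k , k∉N[v]) =
    let γ , nonNeighbours⊆ball = nonNeighbours⊆monoBall₂ k∉N[v] in
    ballCover c v γ k (⊎-map₂ (weaken (n≤1+n 2) ∘ nonNeighbours⊆ball) ∘ near-or-nonNeighbour nbhd)
  ... | no none =
    ballCover c v c v λ z → [ inj₁ , (λ z∉N[v] → ⊥-elim (none (z , z∉N[v]))) ] (near-or-nonNeighbour nbhd z)

  cover-one-colour : ∀ {α x y} → (∀ {z} → NonNeighbour G y z → Reach α 2 z x) →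
    (∀ {z} → NonNeighbour G x z → Reach α 2 z y) → BallCover 3
  cover-one-colour {α} {x} {y} nearX nearY with ballCover? 3 α x α y
  ... | inj₁ cover              = cover
  ... | inj₂ (v , ¬rvx , ¬rvy) = cover-from-centre nbhd
    where
    avx = outside⇒adjacent nearY (¬weaken (n≤1+n 2) ¬rvy) (¬walk⇒≢ ¬rvx)
    x→v = edge-sym {H = colourClass (other α)} (colour-edge avx (colour-leaving ¬rvx avx))
    nbhd : ∀ {z} → adj G z v ≡ true → Reach (other α) 2 z v
    nbhd {z} azv with colour-cases α (colour χ z v)
    ... | inj₂ czv = step (colour-edge azv czv) here
    ... | inj₁ czv = step (colour-edge azx (colour-leaving ¬rzx azx)) (step x→v here)
      where
      v→z = edge-sym {H = colourClass α} (colour-edge azv czv)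
      ¬rzx : ¬ Reach α 2 z x
      ¬rzx = ¬rvx ∘ step v→z
      azx = outside⇒adjacent nearY (¬rvy ∘ step v→z) (¬walk⇒≢ ¬rzx)

  -- The vertices missed by the three pairs of balls are pairwise non-adjacent.
  cover-two-colours : ∀ {α x y} → (∀ {z} → NonNeighbour G y z → Reach α 2 z x) →
    (∀ {z} → NonNeighbour G x z → Reach (other α) 2 z y) → BallCover 3
  cover-two-colours {α} {x} {y} nearX nearY
    with ballCover? 3 α x (other α) y | ballCover? 3 α x α y | ballCover? 3 (other α) x (other α) y
  ... | inj₁ cover | _          | _          = cover
  ... | inj₂ _     | inj₁ cover | _          = cover
  ... | inj₂ _     | inj₂ _     | inj₁ cover = cover
  ... | inj₂ (v , ¬rvx , ¬rvy) | inj₂ (w , ¬rwx , ¬rwy) | inj₂ (u , ¬rux , ¬ruy) =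
    ⊥-elim (noTriple (proj₁ uv) (proj₁ uw) (proj₁ vw) (proj₂ uv) (proj₂ uw) (proj₂ vw))
    where
    avx = outside⇒adjacent nearY (¬weaken (n≤1+n 2) ¬rvy) (¬walk⇒≢ ¬rvx)
    avy = outside⇒adjacent nearX (¬weaken (n≤1+n 2) ¬rvx) (¬walk⇒≢ ¬rvy)
    awy = outside⇒adjacent nearX (¬weaken (n≤1+n 2) ¬rwx) (¬walk⇒≢ ¬rwy)
    aux = outside⇒adjacent nearY (¬weaken (n≤1+n 2) ¬ruy) (¬walk⇒≢ ¬rux)
    cux = trans (colour-leaving ¬rux aux) (other-involutive α)
    cvy = trans (colour-leaving ¬rvy avy) (other-involutive α)
    cwy = colour-leaving ¬rwy awy
    uv = separated aux cux avx (colour-leaving ¬rvx avx) ¬rvx ¬rux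
    vw = separated avy cvy awy cwy ¬rwy ¬rvy
    uw = separated aux cux awy cwy ¬rwx ¬ruy

  cover-of-nonadjacent-pair : ∀ {x y} → x ≢ y → adj G x y ≡ false → BallCover 3
  cover-of-nonadjacent-pair {x} {y} x≢y axy
    with nonNeighbours⊆monoBall₂ (x≢y , axy)
       | nonNeighbours⊆monoBall₂ (x≢y ∘ sym , trans (Graph.sym G y x) axy)
  ... | α , nearX | β , nearY with α ≟ β
  ... | yes refl = cover-one-colour nearX nearY
  ... | no α≢β with ≢⇒other α≢β
  ...   | refl = cover-two-colours nearX nearY

theorem2p9 : (n : ℕ) (G : Graph n) → IndependenceNumber G 2 →
  (χ : EdgeColouring G) →
  Σ (Subgraph G) λ H₁ → Σ (Subgraph G) λ H₂ →
    (Monochromatic χ H₁ × ConnectedDiamLE H₁ 6) ×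
    (Monochromatic χ H₂ × ConnectedDiamLE H₂ 6) ×
    (∀ (v : Fin n) → v ∈ verts H₁ ⊎ v ∈ verts H₂)
theorem2p9 n G α≡2 χ with independentPair G α≡2
... | x , y , x≢y , axy =
  ball H₁ 3 x₁ , ball H₂ 3 x₂ ,
  (ball-monochromatic H₁ 3 x₁ χ (colourClass-monochromatic c₁) , ball-connectedDiam H₁ 3 x₁) ,
  (ball-monochromatic H₂ 3 x₂ χ (colourClass-monochromatic c₂) , ball-connectedDiam H₂ 3 x₂) ,
  ⊎-map (∈-ball⁺ H₁ 3 x₁) (∈-ball⁺ H₂ 3 x₂) ∘ covers
  where
  open Colouring χ
  open BallCover (CoveringByBalls.cover-of-nonadjacent-pair χ (noIndependentTriple G α≡2) x≢y axy)
  H₁ = colourClass c₁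
  H₂ = colourClass c₂
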